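{- Let $n\ge 6$ and let $u$ be a sequence on $n$ distinct letters such that every letter occurs at least twice, $fw(u)=4$, $u$ has alternation length $5$, and the first $n$ letters of $u$ are $1\,2\ldots n$. If the last letter of $u$ is $2$, the middle letter of $u$ is $1$, and the letter immediately after this middle $1$ is $3$, then $u=1\,2\ldots n\;1\;3\ldots n\;3\;2$.
   Context: A sequence $s$ contains $u$ if some (not necessarily contiguous) subsequence of $s$ can be changed into $u$ by a one-to-one renaming of letters. An $(r,s)$-formation is a concatenation of $s$ permutations, each of the same set of $r$ distinct letters. The formation width $fw(u)$ is the minimum $s$ such that there exists $r$ for which every $(r,s)$-formation contains $u$. A sequence has alternation length $5$ if it contains $ababa$ (for distinct letters $a,b$) but does not contain $ababab$. Every sequence satisfying the hypotheses has length $2n+1$; its middle letter is its $(n+1)$-st letter. -}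

module Defs where

open import Data.Nat using (ℕ; zero; suc; _+_; _≤_; _<_; _∸_)
open import Data.List using (List; []; _∷_; _++_; map; length; concat; upTo; filter)
open import Data.List.Membership.Propositional using (_∈_)
open import Data.List.Relation.Binary.Sublist.Propositional using (_⊆_)
open import Data.List.Relation.Binary.Permutation.Propositional using (_↭_)
open import Data.List.Relation.Unary.All using (All)
open import Data.List.Relation.Unary.Unique.Propositional using (Unique)
open import Data.Nat.Properties using (_≟_)
open import Data.Product using (Σ; ∃; ∃-syntax; _×_)
open import Relation.Binary.PropositionalEquality using (_≡_)
open import Relation.Nullary using (¬_)

Contains : List ℕ → List ℕ → Set
Contains s u =
  ∃[ t ] (t ⊆ s) × (∃[ ψ ] ((∀ {x y} → x ∈ t → y ∈ t → ψ x ≡ ψ y → x ≡ y) × (map ψ t ≡ u)))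

Formation : ℕ → ℕ → List ℕ → Set
Formation r s w =
  ∃[ base ] (Unique base × length base ≡ r ×
    (∃[ perms ] (length perms ≡ s × All (_↭ base) perms × w ≡ concat perms)))

FormsAt : List ℕ → ℕ → Set
FormsAt u s = ∃[ r ] (∀ w → Formation r s w → Contains w u)

FW≡ : List ℕ → ℕ → Set
FW≡ u k = FormsAt u k × (∀ s → s < k → ¬ FormsAt u s)

count : ℕ → List ℕ → ℕ
count x u = length (filter (x ≟_) u)

AltLength5 : List ℕ → Set
AltLength5 u = Contains u (0 ∷ 1 ∷ 0 ∷ 1 ∷ 0 ∷ [])
             × ¬ Contains u (0 ∷ 1 ∷ 0 ∷ 1 ∷ 0 ∷ 1 ∷ [])

from_len_ : ℕ → ℕ → List ℕ
from a len k = map (a +_) (upTo k)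

module Submission where

-- Since fw(u) = 4, u lies in every (r,4)-formation, in particular in the concatenations of
-- increasing (↑) and decreasing (↓) runs of 0 … r−1 of shapes ↑↑↑↑, ↑↓↑↑ and ↑↓↑↓; so for
-- suitable orders of its letters u splits into four blocks monotone in these directions.
-- Restricting u to five letters 1 2 3 x y (3 < x < y ≤ n) keeps this, the absence of ababab,
-- the last letter 2 and the repetition of every letter, and gives a word starting 1 2 3 x y 1 3.
-- An exhaustive search over such five-letter words leaves three candidates, and only one of
-- them, 1 2 3 x y 1 3 x y 3 2, has a letter occurring three times.  Since u contains ababa,
-- some letter occurs three times in u; an alphabet containing it shows that 3 occurs three
-- times, and then every restriction to 1 2 3 x y ends in x y 3 2.  These restrictions fix
-- the order of any two of the letters 4, …, n, 3, 2 after 1 3, hence the whole tail.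

open import Defs
open import Level using (0ℓ)
open import Function using (Equivalence; _on_; _∘_; id)
open import Data.Bool using (Bool; true; false; T; not; _∧_; _∨_; if_then_else_)
open import Data.Bool.Properties using (T-∧; T-∨)
open import Data.Bool.ListAction using (all; any)
open import Data.Empty using (⊥-elim)
open import Data.Unit using (tt)
open import Data.Product using (∃-syntax; _×_; _,_; proj₁; proj₂)
open import Data.Sum using (_⊎_; inj₁; inj₂)
open import Data.Maybe using (just)
import Data.Maybe.Properties as Maybe
open import Data.Nat using (ℕ; zero; suc; _+_; _∸_; _<_; _≤_; z≤n; s≤s; z<s; s<s; _<ᵇ_)
open import Data.Nat.Properties
  using (_≟_; _<?_; ≤-refl; ≤-trans; ≤-antisym; <-irrefl; <-trans; <-≤-trans; <-cmp; <⇒≤; <⇒≢; <⇒≱; ≮⇒≥;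
         <⇒≤pred; n<1+n; n≤1+n; m≤n⇒m≤1+n; m≤m+n; +-identityʳ; +-suc; +-monoʳ-<; +-cancelˡ-<; m+[n∸m]≡n;
         <ᵇ⇒<; <⇒<ᵇ)
open import Data.List
  using (List; []; _∷_; _++_; map; length; filter; concat; concatMap; null; last; take; drop;
         upTo; downFrom; applyUpTo; cartesianProductWith)
open import Data.List.Properties
  using (++-assoc; ++-cancelˡ; ++-identityʳ; ∷-injective; ∷-injectiveˡ; ∷-injectiveʳ; map-++; map-cong; map-id;
         map-id-local; map-upTo; map-∘; length-map; length-upTo; length-applyUpTo; reverse-upTo;
         filter-++; filter-accept; filter-reject; filter-notAll; take++drop≡id)
open import Data.List.Membership.Propositional using (_∈_; _∉_)
open import Data.List.Membership.Propositional.Properties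
  using (∈-++⁺ˡ; ∈-++⁺ʳ; ∈-map⁺; ∈-map⁻; ∈-filter⁺; ∈-filter⁻; ∈-upTo⁺; ∈-upTo⁻; ∈-cartesianProductWith⁺)
open import Data.List.Membership.DecPropositional _≟_ using (_∈?_)
open import Data.List.Relation.Unary.Any using (here; there)
import Data.List.Relation.Unary.Any as Any
import Data.List.Relation.Unary.Any.Properties as Any
open import Data.List.Relation.Unary.All using (All; []; _∷_)
import Data.List.Relation.Unary.All as All
import Data.List.Relation.Unary.All.Properties as All
open import Data.List.Relation.Unary.AllPairs using (AllPairs; []; _∷_)
import Data.List.Relation.Unary.AllPairs as AllPairs
import Data.List.Relation.Unary.AllPairs.Properties as AllPairs
open import Data.List.Relation.Unary.Unique.Propositional using (Unique)
import Data.List.Relation.Unary.Unique.Propositional.Properties as Unique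
open import Data.List.Relation.Unary.Unique.DecPropositional _≟_ using (unique?)
open import Data.List.Relation.Binary.Sublist.Propositional using (_⊆_; []; _∷_; _∷ʳ_; ⊆-refl; ⊆-trans; minimum; from∈)
open import Data.List.Relation.Binary.Sublist.Propositional.Properties
  using (++⁺ʳ; All-resp-⊆; Any-resp-⊆; filter-⊆; length-mono-≤)
import Data.List.Relation.Binary.Sublist.Propositional.Properties as Sublist
open import Data.List.Relation.Binary.Sublist.DecPropositional _≟_ using (_⊆?_)
open import Data.List.Relation.Binary.Equality.DecPropositional _≟_ using (_≡?_)
open import Data.List.Membership.DecPropositional _≡?_ using () renaming (_∈?_ to _∈ₗ?_)
open import Data.List.Relation.Binary.Permutation.Propositional using (_↭_; ↭-refl)
open import Data.List.Relation.Binary.Permutation.Propositional.Properties using (↭-reverse)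
open import Relation.Nullary using (¬_; Dec; does; yes; no; contradiction)
open import Relation.Unary using (Pred; Decidable)
open import Relation.Binary.Definitions using (tri<; tri≈; tri>)
open import Relation.Binary.PropositionalEquality

open Equivalence using (to; from)

T-not⇒¬T : ∀ {b} → T (not b) → ¬ T b
T-not⇒¬T {true} ()

T-does⇒ : ∀ {P : Set} (P? : Dec P) → T (does P?) → P
T-does⇒ (yes p) _ = p

does-yes : ∀ {P : Set} (P? : Dec P) → P → T (does P?)
does-yes (yes _) _ = tt
does-yes (no ¬p) p = ¬p p

does-no : ∀ {P : Set} (P? : Dec P) → ¬ P → T (not (does P?))
does-no (yes p) ¬p = ¬p p
does-no (no _) _ = tt

T-all : ∀ {A : Set} {p : A → Bool} {xs x} → T (all p xs) → x ∈ xs → T (p x)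
T-all {p = p} {xs} h = All.lookup (All.all⁺ p xs h)

++-split : ∀ (b w v X : List ℕ) → b ++ w ≡ v ++ X →
           (∃[ m ] (v ≡ b ++ m × w ≡ m ++ X)) ⊎ (∃[ m ] (b ≡ v ++ m))
++-split [] w v X eq = inj₁ (v , refl , eq)
++-split (x ∷ b) w [] X eq = inj₂ (x ∷ b , refl)
++-split (x ∷ b) w (y ∷ v) X eq with refl , eq′ ← ∷-injective eq with ++-split b w v X eq′
... | inj₁ (m , refl , w≡) = inj₁ (m , refl , w≡)
... | inj₂ (m , refl) = inj₂ (m , refl)

⊆-++-split : ∀ {t : List ℕ} xs {ys} → t ⊆ xs ++ ys → ∃[ t₁ ] ∃[ t₂ ] (t ≡ t₁ ++ t₂ × t₁ ⊆ xs × t₂ ⊆ ys)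
⊆-++-split [] sub = [] , _ , refl , [] , sub
⊆-++-split (x ∷ xs) (.x ∷ʳ sub) with t₁ , t₂ , refl , sub₁ , sub₂ ← ⊆-++-split xs sub =
  t₁ , t₂ , refl , x ∷ʳ sub₁ , sub₂
⊆-++-split (x ∷ xs) (refl ∷ sub) with t₁ , t₂ , refl , sub₁ , sub₂ ← ⊆-++-split xs sub =
  x ∷ t₁ , t₂ , refl , refl ∷ sub₁ , sub₂

⊆-map⁻ : ∀ (f : ℕ → ℕ) {p} l → p ⊆ map f l → ∃[ l′ ] (l′ ⊆ l × map f l′ ≡ p)
⊆-map⁻ f [] [] = [] , [] , refl
⊆-map⁻ f (x ∷ l) (_ ∷ʳ sub) with l′ , sub′ , eq ← ⊆-map⁻ f l sub = l′ , x ∷ʳ sub′ , eq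
⊆-map⁻ f (x ∷ l) (refl ∷ sub) with l′ , sub′ , refl ← ⊆-map⁻ f l sub = x ∷ l′ , refl ∷ sub′ , refl

allPairs-⊆ : ∀ {R : ℕ → ℕ → Set} {xs ys : List ℕ} → xs ⊆ ys → AllPairs R ys → AllPairs R xs
allPairs-⊆ [] rs = rs
allPairs-⊆ (y ∷ʳ sub) (_ ∷ rs) = allPairs-⊆ sub rs
allPairs-⊆ (refl ∷ sub) (r ∷ rs) = All-resp-⊆ sub r ∷ allPairs-⊆ sub rs

allPairs-map-local : ∀ {R S : ℕ → ℕ → Set} {P : Pred ℕ 0ℓ} (f : ℕ → ℕ) →
                     (∀ {x y} → P x → P y → R x y → S (f x) (f y)) →
                     ∀ {xs} → All P xs → AllPairs R xs → AllPairs S (map f xs)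
allPairs-map-local f h [] [] = []
allPairs-map-local f h (p ∷ ps) (r ∷ rs) =
  All.map⁺ (All.zipWith (λ (q , r′) → h p q r′) (ps , r)) ∷ allPairs-map-local f h ps rs

filter-map : ∀ {P : Pred ℕ 0ℓ} (P? : Decidable P) (f : ℕ → ℕ) xs → filter P? (map f xs) ≡ map f (filter (P? ∘ f) xs)
filter-map P? f [] = refl
filter-map P? f (x ∷ xs) with P? (f x)
... | yes _ = cong (f x ∷_) (filter-map P? f xs)
... | no _  = filter-map P? f xs

increasing-⊆ : ∀ {xs ys} → AllPairs _<_ xs → AllPairs _<_ ys → All (_∈ ys) xs → xs ⊆ ys
increasing-⊆ {[]} {ys} _ _ _ = minimum ys
increasing-⊆ {x ∷ xs} {y ∷ ys} (x< ∷ ixs) (y< ∷ iys) (here refl ∷ xs∈) =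
  refl ∷ increasing-⊆ ixs iys (All.zipWith (λ (x<z , z∈) → later (<⇒≢ x<z ∘ sym) z∈) (x< , xs∈))
  where
  later : ∀ {z} → z ≢ y → z ∈ y ∷ ys → z ∈ ys
  later z≢y (here z≡y) = contradiction z≡y z≢y
  later _   (there z∈) = z∈
increasing-⊆ {x ∷ xs} {y ∷ ys} ixs@(x< ∷ _) (y< ∷ iys) (there x∈ys ∷ xs∈) =
  y ∷ʳ increasing-⊆ ixs iys (x∈ys ∷ All.zipWith (λ (x<z , z∈) → later (y<x , x<z) z∈) (x< , xs∈))
  where
  y<x : y < x
  y<x = All.lookup y< x∈ys
  later : ∀ {z} → y < x × x < z → z ∈ y ∷ ys → z ∈ ys
  later (y<x , x<z) (here refl) = contradiction (<-trans y<x x<z) (<-irrefl refl)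
  later _           (there z∈)  = z∈

last-∷ʳ : ∀ xs {x : ℕ} → last (xs ++ x ∷ []) ≡ just x
last-∷ʳ [] = refl
last-∷ʳ (_ ∷ []) = refl
last-∷ʳ (_ ∷ xs@(_ ∷ _)) = last-∷ʳ xs

module _ {P Q : Pred ℕ 0ℓ} (P? : Decidable P) (Q? : Decidable Q) (P⇒Q : ∀ {x} → P x → Q x) where

  length-filter-mono : ∀ xs → length (filter P? xs) ≤ length (filter Q? xs)
  length-filter-mono xs = length-mono-≤ (Sublist.filter⁺ P? Q? (λ { refl → P⇒Q }) (⊆-refl {x = xs}))

  length-filter-strict : ∀ {xs y} → y ∈ xs → ¬ P y → Q y → length (filter P? xs) < length (filter Q? xs)
  length-filter-strict {y ∷ xs} (here refl) ¬Py Qy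
    rewrite filter-reject P? {xs = xs} ¬Py | filter-accept Q? {xs = xs} Qy = s≤s (length-filter-mono xs)
  length-filter-strict {x ∷ xs} (there y∈xs) ¬Py Qy with P? x | Q? x
  ... | yes _   | yes _   = s≤s (length-filter-strict y∈xs ¬Py Qy)
  ... | yes Px  | no ¬Qx  = contradiction (P⇒Q Px) ¬Qx
  ... | no _    | yes _   = m≤n⇒m≤1+n (length-filter-strict y∈xs ¬Py Qy)
  ... | no _    | no _    = length-filter-strict y∈xs ¬Py Qy

from-suc : ∀ a k → from a len (suc k) ≡ a ∷ from (suc a) len k
from-suc a k = cong₂ _∷_ (+-identityʳ a) (begin
  map (a +_) (applyUpTo suc k)      ≡⟨ cong (map (a +_)) (map-upTo suc k) ⟨
  map (a +_) (map suc (upTo k))     ≡⟨ map-∘ (upTo k) ⟨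
  map (λ i → a + suc i) (upTo k)    ≡⟨ map-cong (+-suc a) (upTo k) ⟩
  map (suc a +_) (upTo k)           ∎)
  where open ≡-Reasoning

∈-from⁻ : ∀ {a k z} → z ∈ from a len k → a ≤ z × z < a + k
∈-from⁻ {a} z∈ with i , i∈ , refl ← ∈-map⁻ (a +_) z∈ = m≤m+n a i , +-monoʳ-< a (∈-upTo⁻ i∈)

∈-from⁺ : ∀ {a k z} → a ≤ z → z < a + k → z ∈ from a len k
∈-from⁺ {a} {k} {z} a≤z z<a+k = subst (_∈ from a len k) a+[z∸a]≡z
  (∈-map⁺ (a +_) (∈-upTo⁺ (+-cancelˡ-< a (z ∸ a) k (subst (_< a + k) (sym a+[z∸a]≡z) z<a+k))))
  where
  a+[z∸a]≡z : a + (z ∸ a) ≡ z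
  a+[z∸a]≡z = m+[n∸m]≡n a≤z

from-increasing : ∀ a k → AllPairs _<_ (from a len k)
from-increasing a k = AllPairs.map⁺ (AllPairs.map (+-monoʳ-< a) (AllPairs.applyUpTo⁺₁ id k (λ i<j _ → i<j)))

-- Restricting a word to an alphabet

restrict : List ℕ → List ℕ → List ℕ
restrict A = filter (_∈? A)

position : List ℕ → ℕ → ℕ
position [] z = 0
position (a ∷ A) z with z ≟ a
... | yes _ = 0
... | no _ = suc (position A z)

-- nth xs i is 0 when i is out of range.
nth : List ℕ → ℕ → ℕ
nth [] _ = 0
nth (x ∷ xs) zero = x
nth (x ∷ xs) (suc i) = nth xs i

encode : List ℕ → List ℕ → List ℕ
encode A w = map (position A) (restrict A w)

nth-position : ∀ A {z} → z ∈ A → nth A (position A z) ≡ z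
nth-position (a ∷ A) {z} z∈A with z ≟ a
nth-position (a ∷ A) _           | yes z≡a = sym z≡a
nth-position (a ∷ A) (here z≡a)  | no z≢a = ⊥-elim (z≢a z≡a)
nth-position (a ∷ A) (there z∈A) | no _ = nth-position A z∈A

position-< : ∀ A {z} → z ∈ A → position A z < length A
position-< (a ∷ A) {z} z∈A with z ≟ a
position-< (a ∷ A) _           | yes _ = z<s
position-< (a ∷ A) (here z≡a)  | no z≢a = ⊥-elim (z≢a z≡a)
position-< (a ∷ A) (there z∈A) | no _ = s<s (position-< A z∈A)

position-injective : ∀ A {x y} → x ∈ A → y ∈ A → position A x ≡ position A y → x ≡ y
position-injective A x∈ y∈ eq = trans (sym (nth-position A x∈)) (trans (cong (nth A) eq) (nth-position A y∈))

nth-∈ : ∀ A {i} → i < length A → nth A i ∈ A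
nth-∈ (a ∷ A) {zero} _ = here refl
nth-∈ (a ∷ A) {suc i} (s<s i<n) = there (nth-∈ A i<n)

nth-injective : ∀ {A} → Unique A → ∀ {i j} → i < length A → j < length A → nth A i ≡ nth A j → i ≡ j
nth-injective (_ ∷ _) {zero} {zero} _ _ _ = refl
nth-injective (a∉A ∷ _) {zero} {suc j} _ (s<s j<n) a≡ = ⊥-elim (All.lookup a∉A (nth-∈ _ j<n) a≡)
nth-injective (a∉A ∷ _) {suc i} {zero} (s<s i<n) _ ≡a = ⊥-elim (All.lookup a∉A (nth-∈ _ i<n) (sym ≡a))
nth-injective (_ ∷ uA) {suc i} {suc j} (s<s i<n) (s<s j<n) eq = cong suc (nth-injective uA i<n j<n eq)

position-nth : ∀ {A} → Unique A → ∀ {i} → i < length A → position A (nth A i) ≡ i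
position-nth {A} uA {i} i<n =
  nth-injective uA (position-< A (nth-∈ A i<n)) i<n (nth-position A (nth-∈ A i<n))

nth-applyUpTo : ∀ f {k i} → i < k → nth (applyUpTo f k) i ≡ f i
nth-applyUpTo f {suc k} {zero} _ = refl
nth-applyUpTo f {suc k} {suc i} (s<s i<k) = nth-applyUpTo (f ∘ suc) i<k

encode-< : ∀ A w {c} → c ∈ encode A w → c < length A
encode-< A w c∈ with _ , z∈ , refl ← ∈-map⁻ (position A) c∈ = position-< A (proj₂ (∈-filter⁻ (_∈? A) {xs = w} z∈))

decode-encode : ∀ A w → map (nth A) (encode A w) ≡ restrict A w
decode-encode A w = begin
  map (nth A) (map (position A) (restrict A w)) ≡⟨ map-∘ (restrict A w) ⟨
  map (nth A ∘ position A) (restrict A w)       ≡⟨ map-id-local (All.map (nth-position A) (All.all-filter (_∈? A) w)) ⟩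
  restrict A w ∎
  where open ≡-Reasoning

restrict-∷-∈ : ∀ {A z} u → z ∈ A → restrict A (z ∷ u) ≡ z ∷ restrict A u
restrict-∷-∈ {A} u = filter-accept (_∈? A) {xs = u}

restrict-∷-∉ : ∀ {A z} u → z ∉ A → restrict A (z ∷ u) ≡ restrict A u
restrict-∷-∉ {A} u = filter-reject (_∈? A) {xs = u}

encode-∷ʳ : ∀ A w {z} → z ∈ A → encode A (w ++ z ∷ []) ≡ encode A w ++ position A z ∷ []
encode-∷ʳ A w {z} z∈ = begin
  map (position A) (restrict A (w ++ z ∷ []))            ≡⟨ cong (map (position A)) (filter-++ (_∈? A) w (z ∷ [])) ⟩
  map (position A) (restrict A w ++ restrict A (z ∷ [])) ≡⟨ cong (λ r → map (position A) (restrict A w ++ r)) (restrict-∷-∈ [] z∈) ⟩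
  map (position A) (restrict A w ++ z ∷ [])              ≡⟨ map-++ (position A) (restrict A w) (z ∷ []) ⟩
  encode A w ++ position A z ∷ []                        ∎
  where open ≡-Reasoning

restrict-cong : ∀ {A B} u → (∀ {z} → z ∈ u → z ∈ A → z ∈ B) → (∀ {z} → z ∈ u → z ∈ B → z ∈ A) →
                restrict A u ≡ restrict B u
restrict-cong [] _ _ = refl
restrict-cong {A} {B} (z ∷ u) A⇒B B⇒A = by-cases (z ∈? A)
  where
  rest : restrict A u ≡ restrict B u
  rest = restrict-cong u (A⇒B ∘ there) (B⇒A ∘ there)
  by-cases : Dec (z ∈ A) → restrict A (z ∷ u) ≡ restrict B (z ∷ u)
  by-cases (yes z∈A) = trans (restrict-∷-∈ u z∈A)
                         (trans (cong (z ∷_) rest) (sym (restrict-∷-∈ u (A⇒B (here refl) z∈A))))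
  by-cases (no z∉A)  = trans (restrict-∷-∉ u z∉A)
                         (trans rest (sym (restrict-∷-∉ u (z∉A ∘ B⇒A (here refl)))))

restrict-restrict : ∀ {A B} → (∀ {z} → z ∈ B → z ∈ A) → ∀ u → restrict B (restrict A u) ≡ restrict B u
restrict-restrict B⊆A [] = refl
restrict-restrict {A} {B} B⊆A (z ∷ u) = by-cases (z ∈? A) (z ∈? B)
  where
  rest : restrict B (restrict A u) ≡ restrict B u
  rest = restrict-restrict B⊆A u
  by-cases : Dec (z ∈ A) → Dec (z ∈ B) → restrict B (restrict A (z ∷ u)) ≡ restrict B (z ∷ u)
  by-cases (yes z∈A) (yes z∈B) = trans (cong (restrict B) (restrict-∷-∈ u z∈A))
    (trans (restrict-∷-∈ _ z∈B) (trans (cong (z ∷_) rest) (sym (restrict-∷-∈ u z∈B))))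
  by-cases (yes z∈A) (no z∉B)  = trans (cong (restrict B) (restrict-∷-∈ u z∈A))
    (trans (restrict-∷-∉ _ z∉B) (trans rest (sym (restrict-∷-∉ u z∉B))))
  by-cases (no z∉A) _          = trans (cong (restrict B) (restrict-∷-∉ u z∉A))
    (trans rest (sym (restrict-∷-∉ u (z∉A ∘ B⊆A))))

restrict-sublist : ∀ {B W} → Unique W → B ⊆ W → restrict B W ≡ B
restrict-sublist [] [] = refl
restrict-sublist {B} (w∉W ∷ uW) (w ∷ʳ B⊆W) =
  trans (restrict-∷-∉ _ (λ w∈B → All.lookup w∉W (Any-resp-⊆ B⊆W w∈B) refl)) (restrict-sublist uW B⊆W)
restrict-sublist {w ∷ B} (w∉W ∷ uW) (refl ∷ B⊆W) =
  trans (restrict-∷-∈ _ (here refl)) (cong (w ∷_) (trans (restrict-cong _ drop-w (λ _ → there)) (restrict-sublist uW B⊆W)))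
  where
  drop-w : ∀ {z} → z ∈ _ → z ∈ w ∷ B → z ∈ B
  drop-w z∈W (here refl) = contradiction refl (All.lookup w∉W z∈W)
  drop-w _   (there z∈B) = z∈B

determined-by-short-sublists : ∀ {S R} → Unique S → All (_∈ S) R →
                               (∀ {B} → B ⊆ S → length B ≤ 2 → restrict B R ≡ B) → R ≡ S
determined-by-short-sublists {[]} {[]} _ _ _ = refl
determined-by-short-sublists {[]} {_ ∷ _} _ (() ∷ _) _
determined-by-short-sublists {s ∷ S} {[]} _ _ short with () ← short (refl ∷ minimum S) (s≤s z≤n)
determined-by-short-sublists {s ∷ S} {r ∷ R} (s∉S ∷ uS) (r∈ ∷ R∈) short = with-head (head≡ r∈)
  where
  one : restrict (s ∷ []) (r ∷ R) ≡ s ∷ []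
  one = short (refl ∷ minimum S) (s≤s z≤n)

  head≡ : r ∈ s ∷ S → r ≡ s
  head≡ (here r≡s) = r≡s
  head≡ (there r∈S) =
    ∷-injectiveˡ (trans (sym (restrict-∷-∈ R (there (here refl)))) (short (refl ∷ from∈ r∈S) (s≤s (s≤s z≤n))))

  with-head : r ≡ s → r ∷ R ≡ s ∷ S
  with-head refl = cong (s ∷_) (determined-by-short-sublists uS R∈S short′)
    where
    s∉R : s ∉ R
    s∉R s∈R with () ← subst (s ∈_) (∷-injectiveʳ (trans (sym (restrict-∷-∈ R (here refl))) one))
                               (∈-filter⁺ (_∈? s ∷ []) s∈R (here refl))

    R∈S : All (_∈ S) R
    R∈S = All.tabulate λ z∈R → later z∈R (All.lookup R∈ z∈R)
      where later : ∀ {z} → z ∈ R → z ∈ s ∷ S → z ∈ S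
            later z∈R (here refl) = contradiction z∈R s∉R
            later _   (there z∈S) = z∈S

    short′ : ∀ {B} → B ⊆ S → length B ≤ 2 → restrict B R ≡ B
    short′ B⊆S |B|≤2 = trans (sym (restrict-∷-∉ R λ s∈B → All.lookup s∉S (Any-resp-⊆ B⊆S s∈B) refl))
                           (short (s ∷ʳ B⊆S) |B|≤2)

count-∷-≡ : ∀ {a} l → count a (a ∷ l) ≡ suc (count a l)
count-∷-≡ {a} l = cong length (filter-accept (a ≟_) {xs = l} refl)

count-∷-≢ : ∀ {a z} l → a ≢ z → count a (z ∷ l) ≡ count a l
count-∷-≢ {a} l a≢z = cong length (filter-reject (a ≟_) {xs = l} a≢z)

count-cong-∷ : ∀ {a} z {l l′} → count a l ≡ count a l′ → count a (z ∷ l) ≡ count a (z ∷ l′)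
count-cong-∷ {a} z {l} {l′} eq with a ≟ z
... | yes refl = trans (count-∷-≡ l) (trans (cong suc eq) (sym (count-∷-≡ l′)))
... | no a≢z   = trans (count-∷-≢ l a≢z) (trans eq (sym (count-∷-≢ l′ a≢z)))

count-mono-⊆ : ∀ a {xs ys} → xs ⊆ ys → count a xs ≤ count a ys
count-mono-⊆ a xs⊆ys = length-mono-≤ (Sublist.filter⁺ (a ≟_) (a ≟_) (λ { refl a≡ → a≡ }) xs⊆ys)

count-restrict : ∀ A {a} → a ∈ A → ∀ u → count a (restrict A u) ≡ count a u
count-restrict A a∈ [] = refl
count-restrict A {a} a∈ (z ∷ u) = by-cases (z ∈? A)
  where
  by-cases : Dec (z ∈ A) → count a (restrict A (z ∷ u)) ≡ count a (z ∷ u)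
  by-cases (yes z∈) = trans (cong (count a) (restrict-∷-∈ u z∈)) (count-cong-∷ {a} z (count-restrict A a∈ u))
  by-cases (no z∉)  = trans (cong (count a) (restrict-∷-∉ u z∉))
                        (trans (count-restrict A a∈ u) (sym (count-∷-≢ u λ { refl → z∉ a∈ })))

count-map-position : ∀ {A} → Unique A → ∀ {c} → c < length A → ∀ {l} → All (_∈ A) l →
                     count c (map (position A) l) ≡ count (nth A c) l
count-map-position uA c< [] = refl
count-map-position {A} uA {c} c< {z ∷ l} (z∈ ∷ l∈) with c ≟ position A z
... | yes refl = begin
  count (position A z) (position A z ∷ map (position A) l) ≡⟨ count-∷-≡ (map (position A) l) ⟩
  suc (count (position A z) (map (position A) l))           ≡⟨ cong suc (count-map-position uA c< l∈) ⟩
  suc (count (nth A (position A z)) l)                      ≡⟨ cong (λ a → suc (count a l)) (nth-position A z∈) ⟩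
  suc (count z l)                                           ≡⟨ count-∷-≡ l ⟨
  count z (z ∷ l)                                           ≡⟨ cong (λ a → count a (z ∷ l)) (nth-position A z∈) ⟨
  count (nth A (position A z)) (z ∷ l)                      ∎
  where open ≡-Reasoning
... | no c≢ = trans (count-∷-≢ _ c≢) (trans (count-map-position uA c< l∈)
                (sym (count-∷-≢ l λ nth≡z → c≢ (trans (sym (position-nth uA c<)) (cong (position A) nth≡z)))))

count-encode : ∀ {A} → Unique A → ∀ {c} → c < length A → ∀ u → count c (encode A u) ≡ count (nth A c) u
count-encode {A} uA c< u =
  trans (count-map-position uA c< (All.all-filter (_∈? A) u)) (count-restrict A (nth-∈ A c<) u)

⊆-encode⇒contains : ∀ A u {p} → p ⊆ encode A u → Contains u p
⊆-encode⇒contains A u sub with l , l⊆ , refl ← ⊆-map⁻ (position A) (restrict A u) sub =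
  l , ⊆-trans l⊆ (filter-⊆ (_∈? A) u) , position A ,
  (λ x∈ y∈ → position-injective A (kept x∈) (kept y∈)) , refl
  where
  kept : ∀ {x} → x ∈ l → x ∈ A
  kept x∈ = proj₂ (∈-filter⁻ (_∈? A) {xs = u} (Any-resp-⊆ l⊆ x∈))

contains-rename : ∀ {u p} → Contains u p → (f : ℕ → ℕ) →
                  (∀ {x y} → x ∈ p → y ∈ p → f x ≡ f y → x ≡ y) → Contains u (map f p)
contains-rename (t , t⊆u , ψ , ψ-injective , refl) f f-injective =
  t , t⊆u , f ∘ ψ ,
  (λ x∈ y∈ eq → ψ-injective x∈ y∈ (f-injective (∈-map⁺ ψ x∈) (∈-map⁺ ψ y∈) eq)) ,
  map-∘ t

contains-ababa⇒thrice : ∀ {u} → Contains u (0 ∷ 1 ∷ 0 ∷ 1 ∷ 0 ∷ []) → ∃[ z ] (z ∈ u × 3 ≤ count z u)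
contains-ababa⇒thrice {u} (a ∷ b ∷ c ∷ d ∷ e ∷ [] , sub , ψ , ψ-injective , ψt≡) =
  a , Any-resp-⊆ sub (here refl) , subst (_≤ count a u) three (count-mono-⊆ a aaa⊆u)
  where
  letter : ∀ i → nth (map ψ (a ∷ b ∷ c ∷ d ∷ e ∷ [])) i ≡ nth (0 ∷ 1 ∷ 0 ∷ 1 ∷ 0 ∷ []) i
  letter i = cong (λ w → nth w i) ψt≡
  c≡a : c ≡ a
  c≡a = ψ-injective (there (there (here refl))) (here refl) (trans (letter 2) (sym (letter 0)))
  e≡a : e ≡ a
  e≡a = ψ-injective (there (there (there (there (here refl))))) (here refl) (trans (letter 4) (sym (letter 0)))
  aaa⊆u : a ∷ a ∷ a ∷ [] ⊆ u
  aaa⊆u = ⊆-trans (refl ∷ b ∷ʳ sym c≡a ∷ d ∷ʳ sym e≡a ∷ []) sub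
  three : count a (a ∷ a ∷ a ∷ []) ≡ 3
  three = trans (count-∷-≡ {a} _) (cong suc (trans (count-∷-≡ {a} _) (cong suc (count-∷-≡ {a} []))))

-- Monotone block decompositions

Ordered : Bool → ℕ → ℕ → Set
Ordered true  a b = a < b
Ordered false a b = b < a

data MonotoneBlocks (key : ℕ → ℕ) : List Bool → List ℕ → Set where
  [] : MonotoneBlocks key [] []
  block : ∀ {d ds} b {w} → AllPairs (Ordered d on key) b → MonotoneBlocks key ds w →
          MonotoneBlocks key (d ∷ ds) (b ++ w)

module _ {key : ℕ → ℕ} where

  blocks-empty : ∀ ds → MonotoneBlocks key ds []
  blocks-empty [] = []
  blocks-empty (d ∷ ds) = block [] [] (blocks-empty ds)

  blocks-filter : ∀ {p} {P : Pred ℕ p} (P? : Decidable P) {ds w} →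
                  MonotoneBlocks key ds w → MonotoneBlocks key ds (filter P? w)
  blocks-filter P? [] = []
  blocks-filter P? {d ∷ ds} (block b {w} ob bs) =
    subst (MonotoneBlocks key (d ∷ ds)) (sym (filter-++ P? b w))
      (block (filter P? b) (AllPairs.filter⁺ P? ob) (blocks-filter P? bs))

  blocks-prefix : ∀ {ds w} → MonotoneBlocks key ds w → ∀ v X → w ≡ v ++ X → MonotoneBlocks key ds v
  blocks-prefix [] [] X _ = []
  blocks-prefix (block b {w} ob bs) v X eq with ++-split b w v X eq
  ... | inj₁ (m , refl , w≡) = block b ob (blocks-prefix bs m X w≡)
  ... | inj₂ (m , refl) =
    subst (MonotoneBlocks key _) (++-identityʳ v) (block v (allPairs-⊆ (++⁺ʳ m ⊆-refl) ob) (blocks-empty _))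

blocks-map-local : ∀ {key key′ : ℕ → ℕ} {P : Pred ℕ 0ℓ} (f : ℕ → ℕ) →
                   (∀ {d x y} → P x → P y → Ordered d (key x) (key y) → Ordered d (key′ (f x)) (key′ (f y))) →
                   ∀ {ds w} → All P w → MonotoneBlocks key ds w → MonotoneBlocks key′ ds (map f w)
blocks-map-local f h _ [] = []
blocks-map-local {key′ = key′} f h {d ∷ ds} ps (block b {w} ob bs) =
  subst (MonotoneBlocks key′ (d ∷ ds)) (sym (map-++ f b w))
    (block (map f b) (allPairs-map-local f h (All.++⁻ˡ b ps) ob)
                     (blocks-map-local f h (All.++⁻ʳ b ps) bs))

blocks-key-local : ∀ {key key′ : ℕ → ℕ} {P : Pred ℕ 0ℓ} → (∀ {x} → P x → key x ≡ key′ x) →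
                   ∀ {ds w} → All P w → MonotoneBlocks key ds w → MonotoneBlocks key′ ds w
blocks-key-local {key′ = key′} key≡ Pw blocks =
  subst (MonotoneBlocks key′ _) (map-id _)
    (blocks-map-local id (λ {d} Px Py → subst₂ (Ordered d) (key≡ Px) (key≡ Py)) Pw blocks)

run : ℕ → Bool → List ℕ
run r true  = upTo r
run r false = downFrom r

runs : ℕ → List Bool → List ℕ
runs r ds = concat (map (run r) ds)

run-ordered : ∀ r d → AllPairs (Ordered d) (run r d)
run-ordered r true  = AllPairs.applyUpTo⁺₁ id r (λ i<j _ → i<j)
run-ordered r false = AllPairs.applyDownFrom⁺₁ id r (λ j<i _ → j<i)

run-↭ : ∀ r d → run r d ↭ upTo r
run-↭ r true  = ↭-refl
run-↭ r false = subst (_↭ upTo r) (reverse-upTo r) (↭-reverse (upTo r))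

runs-formation : ∀ r ds → Formation r (length ds) (runs r ds)
runs-formation r ds =
  upTo r , Unique.upTo⁺ r , length-upTo r , map (run r) ds , length-map (run r) ds ,
  All.map⁺ (All.tabulate (λ {d} _ → run-↭ r d)) , refl

⊆-runs⇒blocks : ∀ r ds {t} → t ⊆ runs r ds → MonotoneBlocks id ds t
⊆-runs⇒blocks r [] [] = []
⊆-runs⇒blocks r (d ∷ ds) sub with t₁ , t₂ , refl , sub₁ , sub₂ ← ⊆-++-split (run r d) sub =
  block t₁ (allPairs-⊆ sub₁ (run-ordered r d)) (⊆-runs⇒blocks r ds sub₂)

BlockShaped : List Bool → List ℕ → Set
BlockShaped ds u =
  ∃[ t ] ∃[ ψ ] ((∀ {x y} → x ∈ t → y ∈ t → ψ x ≡ ψ y → x ≡ y) × map ψ t ≡ u × MonotoneBlocks id ds t)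

formsAt⇒blockShaped : ∀ {u} ds → FormsAt u (length ds) → BlockShaped ds u
formsAt⇒blockShaped ds (r , contains) with t , sub , ψ , inj , eq ← contains _ (runs-formation r ds) =
  t , ψ , inj , eq , ⊆-runs⇒blocks r ds sub

ordered? : Bool → ℕ → ℕ → Bool
ordered? true  a b = a <ᵇ b
ordered? false a b = b <ᵇ a

ordered⇒ordered? : ∀ d {a b} → Ordered d a b → T (ordered? d a b)
ordered⇒ordered? true  = <⇒<ᵇ
ordered⇒ordered? false = <⇒<ᵇ

stripAfter : Bool → (ℕ → ℕ) → ℕ → List ℕ → List ℕ
stripAfter d key a [] = []
stripAfter d key a (b ∷ w) = if ordered? d (key a) (key b) then stripAfter d key b w else b ∷ w

stripRun : Bool → (ℕ → ℕ) → List ℕ → List ℕ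
stripRun d key [] = []
stripRun d key (a ∷ w) = stripAfter d key a w

fitsBlocks : List Bool → (ℕ → ℕ) → List ℕ → Bool
fitsBlocks [] key w = null w
fitsBlocks (d ∷ ds) key w = fitsBlocks ds key (stripRun d key w)

_IsSuffixOf_ : List ℕ → List ℕ → Set
v IsSuffixOf w = ∃[ e ] (w ≡ e ++ v)

suffix-trans : ∀ {u v w} → u IsSuffixOf v → v IsSuffixOf w → u IsSuffixOf w
suffix-trans {u} (e , refl) (e′ , refl) = e′ ++ e , sym (++-assoc e′ e u)

suffix-cons : ∀ {v w} a → v IsSuffixOf w → v IsSuffixOf (a ∷ w)
suffix-cons a (e , refl) = a ∷ e , refl

module _ (d : Bool) (key : ℕ → ℕ) where

  stripAfter-suffix : ∀ a w → stripAfter d key a w IsSuffixOf w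
  stripAfter-suffix a [] = [] , refl
  stripAfter-suffix a (b ∷ w) with ordered? d (key a) (key b)
  ... | true  = suffix-cons b (stripAfter-suffix b w)
  ... | false = [] , refl

  stripRun-suffix : ∀ w → stripRun d key w IsSuffixOf w
  stripRun-suffix [] = [] , refl
  stripRun-suffix (a ∷ w) = suffix-cons a (stripAfter-suffix a w)

  stripAfter-mono : ∀ a e v → stripRun d key v IsSuffixOf stripAfter d key a (e ++ v)
  stripAfter-mono a [] [] = [] , refl
  stripAfter-mono a [] (b ∷ v) with ordered? d (key a) (key b)
  ... | true  = [] , refl
  ... | false = stripRun-suffix (b ∷ v)
  stripAfter-mono a (b ∷ e) v with ordered? d (key a) (key b)
  ... | true  = stripAfter-mono b e v
  ... | false = suffix-trans (stripRun-suffix v) (b ∷ e , refl)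

  stripRun-mono : ∀ e v → stripRun d key v IsSuffixOf stripRun d key (e ++ v)
  stripRun-mono [] v = [] , refl
  stripRun-mono (a ∷ e) v = stripAfter-mono a e v

  stripAfter-block : ∀ a b w → AllPairs (Ordered d on key) (a ∷ b) → stripAfter d key a (b ++ w) IsSuffixOf w
  stripAfter-block a [] w _ = stripAfter-suffix a w
  stripAfter-block a (b ∷ bs) w ((a<b ∷ _) ∷ ob)
    with ordered? d (key a) (key b) | ordered⇒ordered? d a<b
  ... | true | _ = stripAfter-block b bs w ob

  stripRun-block : ∀ b w → AllPairs (Ordered d on key) b → stripRun d key (b ++ w) IsSuffixOf w
  stripRun-block [] w _ = stripRun-suffix w
  stripRun-block (a ∷ b) w ob = stripAfter-block a b w ob

fitsBlocks-suffix : ∀ ds key {v w} → v IsSuffixOf w → T (fitsBlocks ds key w) → T (fitsBlocks ds key v)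
fitsBlocks-suffix [] key {[]} _ _ = tt
fitsBlocks-suffix [] key {_ ∷ _} ([] , refl) ()
fitsBlocks-suffix [] key {_ ∷ _} (_ ∷ _ , refl) ()
fitsBlocks-suffix (d ∷ ds) key {v} (e , refl) =
  fitsBlocks-suffix ds key (stripRun-mono d key e v)

-- Greedy stripping consumes at least the first block and respects suffixes.  Only this
-- direction is needed: the search merely discards words that fit no ranking.
blocks⇒fitsBlocks : ∀ {key ds w} → MonotoneBlocks key ds w → T (fitsBlocks ds key w)
blocks⇒fitsBlocks [] = tt
blocks⇒fitsBlocks {key} {d ∷ ds} (block b {w} ob bs) =
  fitsBlocks-suffix ds key (stripRun-block d key b w ob) (blocks⇒fitsBlocks bs)

module Ranking (k : ℕ) (τ : ℕ → ℕ) (τ-injective : ∀ {i j} → i < k → j < k → τ i ≡ τ j → i ≡ j) where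

  rank : ℕ → ℕ
  rank i = length (filter (λ j → τ j <? τ i) (upTo k))

  rank-< : ∀ {i} → i < k → rank i < k
  rank-< {i} i<k = subst (rank i <_) (length-upTo k)
    (filter-notAll (λ j → τ j <? τ i) (upTo k) (Any.map (λ { refl → <-irrefl refl }) (∈-upTo⁺ i<k)))

  rank-mono : ∀ {i j} → i < k → τ i < τ j → rank i < rank j
  rank-mono {i} {j} i<k τi<τj =
    length-filter-strict (λ l → τ l <? τ i) (λ l → τ l <? τ j) (λ τl<τi → <-trans τl<τi τi<τj)
      (∈-upTo⁺ i<k) (<-irrefl refl) τi<τj

  rank-injective : ∀ {i j} → i < k → j < k → rank i ≡ rank j → i ≡ j
  rank-injective {i} {j} i<k j<k eq with <-cmp (τ i) (τ j)
  ... | tri< τi<τj _ _ = ⊥-elim (<-irrefl eq (rank-mono i<k τi<τj))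
  ... | tri≈ _ τi≡τj _ = τ-injective i<k j<k τi≡τj
  ... | tri> _ _ τj<τi = ⊥-elim (<-irrefl (sym eq) (rank-mono j<k τj<τi))

preimage : (ℕ → ℕ) → List ℕ → ℕ → ℕ
preimage ψ [] y = 0
preimage ψ (z ∷ zs) y with ψ z ≟ y
... | yes _ = z
... | no _  = preimage ψ zs y

preimage-∈ : ∀ ψ zs {y} → y ∈ map ψ zs → preimage ψ zs y ∈ zs × ψ (preimage ψ zs y) ≡ y
preimage-∈ ψ (z ∷ zs) {y} y∈ with ψ z ≟ y
preimage-∈ ψ (z ∷ zs) _            | yes ψz≡y = here refl , ψz≡y
preimage-∈ ψ (z ∷ zs) (here y≡ψz)  | no ψz≢y  = ⊥-elim (ψz≢y (sym y≡ψz))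
preimage-∈ ψ (z ∷ zs) (there y∈)   | no _     with z′∈ , ψz′≡y ← preimage-∈ ψ zs y∈ = there z′∈ , ψz′≡y

BlockRanking : List Bool → List ℕ → List ℕ → Set
BlockRanking ds A u =
  ∃[ ρ ] ((∀ {i} → i < length A → ρ i < length A) ×
          (∀ {i j} → i < length A → j < length A → ρ i ≡ ρ j → i ≡ j) ×
          MonotoneBlocks ρ ds (encode A u))

encode-blockRanking : ∀ {ds u A} → BlockShaped ds u → Unique A → All (_∈ u) A → BlockRanking ds A u
encode-blockRanking {ds} {A = A} (t , ψ , ψ-injective , refl , blocks) uniqueA A⊆u =
  rank , rank-< , rank-injective , subst (MonotoneBlocks rank ds) (sym encode-ψt) coded-blocks
  where
  k : ℕ
  k = length A

  τ : ℕ → ℕ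
  τ j = preimage ψ t (nth A j)

  τ-spec : ∀ {j} → j < k → τ j ∈ t × ψ (τ j) ≡ nth A j
  τ-spec j<k = preimage-∈ ψ t (All.lookup A⊆u (nth-∈ A j<k))

  τ-injective : ∀ {i j} → i < k → j < k → τ i ≡ τ j → i ≡ j
  τ-injective i<k j<k eq =
    nth-injective uniqueA i<k j<k (trans (sym (proj₂ (τ-spec i<k))) (trans (cong ψ eq) (proj₂ (τ-spec j<k))))

  open Ranking k τ τ-injective

  Kept : ℕ → Set
  Kept z = z ∈ t × ψ z ∈ A

  index : ℕ → ℕ
  index z = position A (ψ z)

  index-< : ∀ {z} → Kept z → index z < k
  index-< (_ , ψz∈A) = position-< A ψz∈A

  τ-index : ∀ {z} → Kept z → τ (index z) ≡ z
  τ-index {z} kz@(z∈t , ψz∈A) with τz∈t , ψτz≡ ← τ-spec (index-< kz) =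
    ψ-injective τz∈t z∈t (trans ψτz≡ (nth-position A ψz∈A))

  rank-index-ordered : ∀ {d x y} → Kept x → Kept y → Ordered d x y → Ordered d (rank (index x)) (rank (index y))
  rank-index-ordered {true}  kx ky x<y = rank-mono (index-< kx) (subst₂ _<_ (sym (τ-index kx)) (sym (τ-index ky)) x<y)
  rank-index-ordered {false} kx ky y<x = rank-mono (index-< ky) (subst₂ _<_ (sym (τ-index ky)) (sym (τ-index kx)) y<x)

  kept : List ℕ
  kept = filter ((_∈? A) ∘ ψ) t

  all-kept : All Kept kept
  all-kept = All.tabulate (∈-filter⁻ ((_∈? A) ∘ ψ) {xs = t})

  encode-ψt : encode A (map ψ t) ≡ map index kept
  encode-ψt = trans (cong (map (position A)) (filter-map (_∈? A) ψ t)) (sym (map-∘ kept))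

  coded-blocks : MonotoneBlocks rank ds (map index kept)
  coded-blocks = blocks-map-local index rank-index-ordered all-kept (blocks-filter ((_∈? A) ∘ ψ) blocks)

-- The computer search

letters : List ℕ
letters = upTo 5

words : ℕ → List (List ℕ)
words zero    = [] ∷ []
words (suc k) = cartesianProductWith _∷_ letters (words k)

insertions : ℕ → List ℕ → List (List ℕ)
insertions x [] = (x ∷ []) ∷ []
insertions x (y ∷ ys) = (x ∷ y ∷ ys) ∷ map (y ∷_) (insertions x ys)

permutations : List ℕ → List (List ℕ)
permutations [] = [] ∷ []
permutations (x ∷ xs) = concatMap (insertions x) (permutations xs)

rankings : List (List ℕ)
rankings = permutations letters

fitsSomeRanking : List Bool → List ℕ → Bool
fitsSomeRanking ds w = any (λ ρ → fitsBlocks ds (nth ρ) w) rankings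

alternation : ℕ → ℕ → List ℕ
alternation c d = c ∷ d ∷ c ∷ d ∷ c ∷ d ∷ []

avoidsAlternation : List ℕ → ℕ → ℕ → Bool
avoidsAlternation w c d = does (c ≟ d) ∨ not (does (alternation c d ⊆? w))

alternationFree : List ℕ → Bool
alternationFree w = all (λ c → all (avoidsAlternation w c) letters) letters

↑↑↑↑ ↑↓↑↑ ↑↓↑↓ : List Bool
↑↑↑↑ = true ∷ true  ∷ true ∷ true  ∷ []
↑↓↑↑ = true ∷ false ∷ true ∷ true  ∷ []
↑↓↑↓ = true ∷ false ∷ true ∷ false ∷ []

admissible : List ℕ → Bool
admissible w = alternationFree w ∧ fitsSomeRanking ↑↓↑↑ w ∧ fitsSomeRanking ↑↓↑↓ w ∧ fitsSomeRanking ↑↑↑↑ w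

-- Ends with the encoding of 2 and repeats every letter.
complete : List ℕ → Bool
complete w = does (Maybe.≡-dec _≟_ (last w) (just 1)) ∧ all (λ c → 1 <ᵇ count c w) letters

-- The encoding of 1 2 … n 1 3 on the alphabet 1 2 3 x y.
prefix : List ℕ
prefix = 0 ∷ 1 ∷ 2 ∷ 3 ∷ 4 ∷ 0 ∷ 2 ∷ []

survivor₃ : List ℕ
survivor₃ = prefix ++ 3 ∷ 4 ∷ 2 ∷ 1 ∷ []

survivors : List (List ℕ)
survivors = (prefix ++ 3 ∷ 4 ∷ 1 ∷ []) ∷ (prefix ++ 4 ∷ 3 ∷ 1 ∷ []) ∷ survivor₃ ∷ []

acceptable : List ℕ → Bool
acceptable w = not (complete w) ∨ does (w ∈ₗ? survivors)

explore : ℕ → List ℕ → Bool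
extensionOK : ℕ → List ℕ → ℕ → Bool

explore f w = all (extensionOK f w) letters

extensionOK zero    w c = not (admissible (w ++ c ∷ []))
extensionOK (suc f) w c = not (admissible w′) ∨ (acceptable w′ ∧ explore f w′)
  where
  w′ : List ℕ
  w′ = w ++ c ∷ []

-- Every extension of prefix whose prefixes are all admissible adds at most 20 letters,
-- and is a survivor if it is complete.
explore-prefix : T (explore 20 prefix)
explore-prefix = _

rankings-complete : T (all (λ w → not (does (unique? w)) ∨ does (w ∈ₗ? rankings)) (words 5))
rankings-complete = _

explore-sound : ∀ f w {X} → T (explore f w) → All (_∈ letters) X → X ≢ [] →
                (∀ Y {Z} → X ≡ Y ++ Z → T (admissible (w ++ Y))) → T (acceptable (w ++ X))
explore-sound f w {[]} _ _ X≢[] _ = ⊥-elim (X≢[] refl)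
explore-sound zero w {c ∷ X} ex (c∈ ∷ _) _ adm = ⊥-elim (T-not⇒¬T (T-all {p = extensionOK zero w} ex c∈) (adm (c ∷ []) refl))
explore-sound (suc f) w {c ∷ X} ex (c∈ ∷ X∈) _ adm with to T-∨ (T-all {p = extensionOK (suc f) w} ex c∈)
... | inj₁ ¬adm = ⊥-elim (T-not⇒¬T ¬adm (adm (c ∷ []) refl))
... | inj₂ acc∧ex = continue X X∈ (to T-∧ acc∧ex) (λ Y eq → adm (c ∷ Y) (cong (c ∷_) eq))
  where
  w′ : List ℕ
  w′ = w ++ c ∷ []
  continue : ∀ X → All (_∈ letters) X → T (acceptable w′) × T (explore f w′) →
             (∀ Y {Z} → X ≡ Y ++ Z → T (admissible (w ++ c ∷ Y))) → T (acceptable (w ++ c ∷ X))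
  continue [] _ (acc , _) _ = acc
  continue X@(_ ∷ _) X∈ (_ , ex′) adm′ =
    subst (T ∘ acceptable) (++-assoc w (c ∷ []) X)
      (explore-sound f w′ ex′ X∈ (λ ())
        (λ Y eq → subst (T ∘ admissible) (sym (++-assoc w (c ∷ []) Y)) (adm′ Y eq)))

acceptable-complete : ∀ {w} → T (acceptable w) → T (complete w) → w ∈ survivors
acceptable-complete {w} acc comp with to T-∨ acc
... | inj₁ ¬comp = ⊥-elim (T-not⇒¬T ¬comp comp)
... | inj₂ w∈ = T-does⇒ (w ∈ₗ? survivors) w∈

words-complete : ∀ {w} → All (_∈ letters) w → w ∈ words (length w)
words-complete [] = here refl
words-complete (c∈ ∷ w∈) = ∈-cartesianProductWith⁺ _∷_ c∈ (words-complete w∈)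

unique-word-∈-rankings : ∀ {w} → length w ≡ 5 → All (_∈ letters) w → Unique w → w ∈ rankings
unique-word-∈-rankings {w} |w|≡5 w∈ uw with to T-∨ (T-all {p = λ w → not (does (unique? w)) ∨ does (w ∈ₗ? rankings)}
                                                  rankings-complete (subst (λ k → w ∈ words k) |w|≡5 (words-complete w∈)))
... | inj₁ ¬uw = ⊥-elim (T-not⇒¬T ¬uw (does-yes (unique? w) uw))
... | inj₂ w∈r = T-does⇒ (w ∈ₗ? rankings) w∈r

alternation-∈ : ∀ {c d x} → x ∈ alternation c d → x ∈ c ∷ d ∷ []
alternation-∈ (here refl) = here refl
alternation-∈ (there (here refl)) = there (here refl)
alternation-∈ (there (there (here refl))) = here refl
alternation-∈ (there (there (there (here refl)))) = there (here refl)
alternation-∈ (there (there (there (there (here refl))))) = here refl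
alternation-∈ (there (there (there (there (there (here refl)))))) = there (here refl)

contains-alternation : ∀ {u c d} → c ≢ d → Contains u (alternation c d) → Contains u (alternation 0 1)
contains-alternation {u} {c} {d} c≢d contains =
  subst (Contains u) canonical (contains-rename contains (position B) injective)
  where
  B : List ℕ
  B = c ∷ d ∷ []
  uniqueB : Unique B
  uniqueB = (c≢d ∷ []) ∷ [] ∷ []
  injective : ∀ {x y} → x ∈ alternation c d → y ∈ alternation c d → position B x ≡ position B y → x ≡ y
  injective x∈ y∈ = position-injective B (alternation-∈ x∈) (alternation-∈ y∈)
  canonical : map (position B) (alternation c d) ≡ alternation 0 1
  canonical rewrite position-nth uniqueB {0} z<s | position-nth uniqueB {1} (s<s z<s) = refl

encode-alternationFree : ∀ A {u} → ¬ Contains u (alternation 0 1) → ∀ v Z → encode A u ≡ v ++ Z →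
                         T (alternationFree v)
encode-alternationFree A {u} free v Z eq =
  All.all⁻ (λ c → all (avoidsAlternation v c) letters) {xs = letters} (All.tabulate λ {c} _ →
    All.all⁻ (avoidsAlternation v c) {xs = letters} (All.tabulate λ {d} _ → pair c d))
  where
  pair : ∀ c d → T (avoidsAlternation v c d)
  pair c d with c ≟ d
  ... | yes c≡d = from T-∨ (inj₁ (does-yes (c ≟ d) c≡d))
  ... | no c≢d  = from T-∨ (inj₂ (does-no (alternation c d ⊆? v) λ sub →
    free (contains-alternation c≢d (⊆-encode⇒contains A u (subst (alternation c d ⊆_) (sym eq) (++⁺ʳ Z sub))))))

blockRanking⇒fitsSomeRanking : ∀ {ds A u} → length A ≡ 5 → BlockRanking ds A u →
                               ∀ v Z → encode A u ≡ v ++ Z → T (fitsSomeRanking ds v)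
blockRanking⇒fitsSomeRanking {ds} {A} {u} |A|≡5 (ρ , ρ-< , ρ-injective , blocks) v Z eq =
  Any.any⁺ (λ r → fitsBlocks ds (nth r) v) (Any.map (λ { refl → fits }) r∈rankings)
  where
  r : List ℕ
  r = applyUpTo ρ 5

  lift : ∀ {i} → i < 5 → i < length A
  lift {i} = subst (i <_) (sym |A|≡5)

  r∈rankings : r ∈ rankings
  r∈rankings = unique-word-∈-rankings (length-applyUpTo ρ 5)
    (All.applyUpTo⁺₁ ρ 5 λ i<5 → ∈-upTo⁺ (subst (ρ _ <_) |A|≡5 (ρ-< (lift i<5))))
    (Unique.applyUpTo⁺₁ ρ 5 λ i<j j<5 ρi≡ρj → <-irrefl (ρ-injective (lift (<-trans i<j j<5)) (lift j<5) ρi≡ρj) i<j)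

  keyed : MonotoneBlocks (nth r) ds (encode A u)
  keyed = blocks-key-local (λ c<5 → sym (nth-applyUpTo ρ c<5))
            (All.tabulate λ c∈ → subst (_ <_) |A|≡5 (encode-< A u c∈)) blocks

  fits : T (fitsBlocks ds (nth r) v)
  fits = blocks⇒fitsBlocks (blocks-prefix keyed v Z eq)

encode-complete : ∀ {A u} → Unique A → length A ≡ 5 → All (_∈ u) A → (∀ {x} → x ∈ u → 2 ≤ count x u) →
                  last (encode A u) ≡ just 1 → T (complete (encode A u))
encode-complete {A} {u} uA |A|≡5 A⊆u twice last≡ =
  from T-∧ (does-yes (Maybe.≡-dec _≟_ _ _) last≡ ,
            All.all⁻ (λ c → 1 <ᵇ count c (encode A u)) {xs = letters} (All.tabulate λ c∈ → <⇒<ᵇ (twice′ c∈)))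
  where
  twice′ : ∀ {c} → c ∈ letters → 2 ≤ count c (encode A u)
  twice′ c∈ with c< ← subst (_ <_) (sym |A|≡5) (∈-upTo⁻ c∈) =
    subst (2 ≤_) (sym (count-encode uA c< u)) (twice (All.lookup A⊆u (nth-∈ A c<)))

encode-survivor : ∀ {A u} → Unique A → length A ≡ 5 → All (_∈ u) A →
                  (∀ {x} → x ∈ u → 2 ≤ count x u) → FormsAt u 4 → ¬ Contains u (alternation 0 1) →
                  last (encode A u) ≡ just 1 → ∀ X → encode A u ≡ prefix ++ X → encode A u ∈ survivors
encode-survivor {A} {u} uA |A|≡5 A⊆u twice forms free last≡ X eq =
  acceptable-complete (subst (T ∘ acceptable) (sym eq) (explore-sound 20 prefix explore-prefix X∈letters X≢[] admissible-prefixes))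
                      (encode-complete uA |A|≡5 A⊆u twice last≡)
  where
  ranked : ∀ ds → length ds ≡ 4 → BlockRanking ds A u
  ranked ds len₄ = encode-blockRanking (formsAt⇒blockShaped ds (subst (FormsAt u) (sym len₄) forms)) uA A⊆u

  X∈letters : All (_∈ letters) X
  X∈letters = All.++⁻ʳ prefix (subst (All (_∈ letters)) eq
                (All.tabulate λ c∈ → ∈-upTo⁺ (subst (_ <_) |A|≡5 (encode-< A u c∈))))

  X≢[] : X ≢ []
  X≢[] refl with () ← trans (sym last≡) (cong last eq)

  admissible-prefixes : ∀ Y {Z} → X ≡ Y ++ Z → T (admissible (prefix ++ Y))
  admissible-prefixes Y {Z} refl =
    from T-∧ (encode-alternationFree A free v Z eq′ ,
    from T-∧ (fits ↑↓↑↑ refl , from T-∧ (fits ↑↓↑↓ refl , fits ↑↑↑↑ refl)))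
    where
    v : List ℕ
    v = prefix ++ Y
    eq′ : encode A u ≡ v ++ Z
    eq′ = trans eq (sym (++-assoc prefix Y Z))
    fits : ∀ ds → length ds ≡ 4 → T (fitsSomeRanking ds v)
    fits ds len₄ = blockRanking⇒fitsSomeRanking {ds} {A} {u} |A|≡5 (ranked ds len₄) v Z eq′

fewer-than-thrice : ∀ s → T (all (λ c → count c s <ᵇ 3) letters) → ∀ {c} → c ∈ letters → ¬ 3 ≤ count c s
fewer-than-thrice s check c∈ = <⇒≱ (<ᵇ⇒< _ 3 (T-all {p = λ c → count c s <ᵇ 3} check c∈))

survivor-thrice : ∀ {s c} → s ∈ survivors → c ∈ letters → 3 ≤ count c s → s ≡ survivor₃
survivor-thrice (here refl)         c∈ = ⊥-elim ∘ (fewer-than-thrice (prefix ++ 3 ∷ 4 ∷ 1 ∷ []) _ c∈)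
survivor-thrice (there (here refl)) c∈ = ⊥-elim ∘ (fewer-than-thrice (prefix ++ 4 ∷ 3 ∷ 1 ∷ []) _ c∈)
survivor-thrice (there (there (here refl))) _ _ = refl

alphabet : ℕ → ℕ → List ℕ
alphabet x y = 1 ∷ 2 ∷ 3 ∷ x ∷ y ∷ []

alphabet-increasing : ∀ {x y} → 3 < x → x < y → AllPairs _<_ (alphabet x y)
alphabet-increasing {x} {y} 3<x x<y =
  (1<2 ∷ 1<3 ∷ 1<x ∷ <-trans 1<x x<y ∷ []) ∷ (2<3 ∷ 2<x ∷ <-trans 2<x x<y ∷ []) ∷
  (3<x ∷ <-trans 3<x x<y ∷ []) ∷ (x<y ∷ []) ∷ [] ∷ []
  where
  1<2 : 1 < 2
  1<2 = s<s z<s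
  2<3 : 2 < 3
  2<3 = s<s 1<2
  1<3 : 1 < 3
  1<3 = <-trans 1<2 2<3
  2<x : 2 < x
  2<x = <-trans 2<3 3<x
  1<x : 1 < x
  1<x = <-trans 1<3 3<x

alphabet-unique : ∀ {x y} → 3 < x → x < y → Unique (alphabet x y)
alphabet-unique 3<x x<y = AllPairs.map <⇒≢ (alphabet-increasing 3<x x<y)

letter-in-alphabet : ∀ {n z} → 6 ≤ n → 1 ≤ z → z ≤ n → ∃[ x ] ∃[ y ] (3 < x × x < y × y ≤ n × z ∈ alphabet x y)
letter-in-alphabet {n} 6≤n lo hi = by-size _ lo hi
  where
  3<4 : 3 < 4
  3<4 = n<1+n 3
  4<n : 4 < n
  4<n = <-trans (n<1+n 4) 6≤n
  basic : ∀ {z} → z ∈ alphabet 4 5 → ∃[ x ] ∃[ y ] (3 < x × x < y × y ≤ n × z ∈ alphabet x y)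
  basic z∈ = 4 , 5 , 3<4 , n<1+n 4 , <⇒≤ 6≤n , z∈
  by-size : ∀ z → 1 ≤ z → z ≤ n → ∃[ x ] ∃[ y ] (3 < x × x < y × y ≤ n × z ∈ alphabet x y)
  by-size 1 _ _ = basic (here refl)
  by-size 2 _ _ = basic (there (here refl))
  by-size 3 _ _ = basic (there (there (here refl)))
  by-size z@(suc (suc (suc (suc _)))) _ hi with z <? n
  ... | yes z<n = z , suc z , s<s (s<s (s<s z<s)) , n<1+n z , z<n , there (there (there (here refl)))
  ... | no z≮n with refl ← ≤-antisym hi (≮⇒≥ z≮n) = 4 , z , 3<4 , 4<n , ≤-refl , there (there (there (there (here refl))))

short-sublist-cover : ∀ {n} → 6 ≤ n → ∀ {B} → B ⊆ from 4 len (n ∸ 3) ++ 3 ∷ 2 ∷ [] → length B ≤ 2 →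
                      ∃[ x ] ∃[ y ] (3 < x × x < y × y ≤ n × B ⊆ x ∷ y ∷ 3 ∷ 2 ∷ [])
short-sublist-cover {n} 6≤n sub |B|≤2 with B₁ , B₂ , refl , B₁⊆ , B₂⊆ ← ⊆-++-split (from 4 len (n ∸ 3)) sub =
  cover B₁ (allPairs-⊆ B₁⊆ (from-increasing 4 (n ∸ 3))) (All.tabulate (bounded ∘ Any-resp-⊆ B₁⊆)) B₂⊆ |B|≤2
  where
  3<4 : 3 < 4
  3<4 = n<1+n 3
  4<n : 4 < n
  4<n = <-trans (n<1+n 4) 6≤n

  bounded : ∀ {z} → z ∈ from 4 len (n ∸ 3) → 3 < z × z ≤ n
  bounded {z} z∈ with 4≤z , z<4+k ← ∈-from⁻ z∈ =
    4≤z , <⇒≤pred (subst (z <_) (cong suc (m+[n∸m]≡n (≤-trans (n≤1+n 3) (<⇒≤ 4<n)))) z<4+k)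

  cover : ∀ B₁ {B₂} → AllPairs _<_ B₁ → All (λ z → 3 < z × z ≤ n) B₁ → B₂ ⊆ 3 ∷ 2 ∷ [] →
          length (B₁ ++ B₂) ≤ 2 →
          ∃[ x ] ∃[ y ] (3 < x × x < y × y ≤ n × B₁ ++ B₂ ⊆ x ∷ y ∷ 3 ∷ 2 ∷ [])
  cover [] _ _ B₂⊆ _ = 4 , 5 , 3<4 , n<1+n 4 , <⇒≤ 6≤n , 4 ∷ʳ 5 ∷ʳ B₂⊆
  cover (a ∷ []) _ ((3<a , a≤n) ∷ []) B₂⊆ _ with a <? n
  ... | yes a<n = a , suc a , 3<a , n<1+n a , a<n , refl ∷ suc a ∷ʳ B₂⊆
  ... | no a≮n with refl ← ≤-antisym a≤n (≮⇒≥ a≮n) = 4 , a , 3<4 , 4<n , ≤-refl , 4 ∷ʳ refl ∷ B₂⊆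
  cover (a ∷ b ∷ []) ((a<b ∷ []) ∷ _) ((3<a , _) ∷ (_ , b≤n) ∷ []) B₂⊆ _ =
    a , b , 3<a , a<b , b≤n , refl ∷ refl ∷ B₂⊆
  cover (_ ∷ _ ∷ _ ∷ _) _ _ _ (s≤s (s≤s ()))

from4-then-3-2-unique : ∀ k → Unique (from 4 len k ++ 3 ∷ 2 ∷ [])
from4-then-3-2-unique k = Unique.++⁺ (AllPairs.map <⇒≢ (from-increasing 4 k)) ((((λ ()) ∷ []) ∷ [] ∷ [])) disjoint
  where
  disjoint : ∀ {v} → ¬ (v ∈ from 4 len k × v ∈ 3 ∷ 2 ∷ [])
  disjoint (v∈ , here refl) with s≤s (s≤s (s≤s ())) ← proj₁ (∈-from⁻ v∈)
  disjoint (v∈ , there (here refl)) with s≤s (s≤s ()) ← proj₁ (∈-from⁻ v∈)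

module _ {n u rest} (6≤n : 6 ≤ n) (range : ∀ {x} → x ∈ u → 1 ≤ x × x ≤ n) (twice : ∀ {x} → x ∈ u → 2 ≤ count x u)
         (forms : FormsAt u 4) (ababa : Contains u (0 ∷ 1 ∷ 0 ∷ 1 ∷ 0 ∷ [])) (free : ¬ Contains u (alternation 0 1))
         (u≡ : u ≡ from 1 len n ++ 1 ∷ 3 ∷ rest) (ends-with-2 : ∃[ init ] u ≡ init ++ 2 ∷ []) where

  module _ {x y} (3<x : 3 < x) (x<y : x < y) (y≤n : y ≤ n) where

    uA : Unique (alphabet x y)
    uA = alphabet-unique 3<x x<y

    alphabet-⊆-from : alphabet x y ⊆ from 1 len n
    alphabet-⊆-from = increasing-⊆ (alphabet-increasing 3<x x<y) (from-increasing 1 n)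
      (small (s≤s z≤n) (s≤s z≤n) ∷ small (s≤s z≤n) (s≤s (s≤s z≤n)) ∷ small (s≤s z≤n) ≤-refl ∷
       ∈-from⁺ 1≤x (s≤s (<⇒≤ (<-≤-trans x<y y≤n))) ∷ ∈-from⁺ (≤-trans 1≤x (<⇒≤ x<y)) (s≤s y≤n) ∷ [])
      where
      small : ∀ {a} → 1 ≤ a → a ≤ 3 → a ∈ from 1 len n
      small lo hi = ∈-from⁺ lo (s≤s (≤-trans hi (<⇒≤ (<-trans (n<1+n 3) (<-trans (n<1+n 4) 6≤n)))))
      1≤x : 1 ≤ x
      1≤x = <-trans z<s 3<x

    restrict-u : restrict (alphabet x y) u ≡ alphabet x y ++ 1 ∷ 3 ∷ restrict (alphabet x y) rest
    restrict-u = begin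
      restrict (alphabet x y) u                                       ≡⟨ cong (restrict (alphabet x y)) u≡ ⟩
      restrict (alphabet x y) (from 1 len n ++ 1 ∷ 3 ∷ rest)          ≡⟨ filter-++ (_∈? alphabet x y) (from 1 len n) _ ⟩
      restrict (alphabet x y) (from 1 len n) ++ 1 ∷ 3 ∷ restrict (alphabet x y) rest
        ≡⟨ cong (_++ _) (restrict-sublist (AllPairs.map <⇒≢ (from-increasing 1 n)) alphabet-⊆-from) ⟩
      alphabet x y ++ 1 ∷ 3 ∷ restrict (alphabet x y) rest            ∎
      where open ≡-Reasoning

    encode-u : encode (alphabet x y) u ≡ prefix ++ encode (alphabet x y) rest
    encode-u rewrite restrict-u | position-nth uA {3} (s<s (s<s (s<s z<s))) | position-nth uA {4} (s<s (s<s (s<s (s<s z<s)))) = refl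

    encode-u-last : last (encode (alphabet x y) u) ≡ just 1
    encode-u-last = let init , u≡init++2 = ends-with-2 in
      trans (cong (last ∘ encode (alphabet x y)) u≡init++2)
            (trans (cong last (encode-∷ʳ (alphabet x y) init (there (here refl)))) (last-∷ʳ (encode (alphabet x y) init)))

    alphabet-⊆-u : All (_∈ u) (alphabet x y)
    alphabet-⊆-u = All.tabulate λ a∈ → subst (_ ∈_) (sym u≡) (∈-++⁺ˡ (Any-resp-⊆ alphabet-⊆-from a∈))

    encode-u-survivor : encode (alphabet x y) u ∈ survivors
    encode-u-survivor = encode-survivor uA refl alphabet-⊆-u twice forms free encode-u-last _ encode-u

    thrice⇒survivor₃ : ∀ {z} → z ∈ alphabet x y → 3 ≤ count z u → encode (alphabet x y) u ≡ survivor₃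
    thrice⇒survivor₃ {z} z∈ thrice = survivor-thrice encode-u-survivor (∈-upTo⁺ z<5)
      (subst (3 ≤_) (sym (trans (count-encode uA z<5 u) (cong (λ a → count a u) (nth-position (alphabet x y) z∈)))) thrice)
      where
      z<5 : position (alphabet x y) z < 5
      z<5 = position-< (alphabet x y) z∈

    restrict-rest : count 3 u ≡ 3 → restrict (alphabet x y) rest ≡ x ∷ y ∷ 3 ∷ 2 ∷ []
    restrict-rest count₃ = begin
      restrict (alphabet x y) rest                         ≡⟨ decode-encode (alphabet x y) rest ⟨
      map (nth (alphabet x y)) (encode (alphabet x y) rest) ≡⟨ cong (map (nth (alphabet x y))) encode-rest ⟩
      x ∷ y ∷ 3 ∷ 2 ∷ []                                   ∎
      where
      open ≡-Reasoning
      encode-rest : encode (alphabet x y) rest ≡ 3 ∷ 4 ∷ 2 ∷ 1 ∷ []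
      encode-rest = ++-cancelˡ prefix _ _
        (trans (sym encode-u) (thrice⇒survivor₃ (there (there (here refl))) (subst (3 ≤_) (sym count₃) ≤-refl)))

  count₃ : count 3 u ≡ 3
  count₃ with z , z∈u , thrice ← contains-ababa⇒thrice ababa
         with x , y , 3<x , x<y , y≤n , z∈A ← letter-in-alphabet 6≤n (proj₁ (range z∈u)) (proj₂ (range z∈u)) =
    trans (sym (count-encode (alphabet-unique 3<x x<y) {2} (s<s (s<s z<s)) u))
          (cong (count 2) (thrice⇒survivor₃ 3<x x<y y≤n z∈A thrice))

  1∉rest : 1 ∉ rest
  1∉rest 1∈rest = not-there (subst (1 ∈_) (restrict-rest (n<1+n 3) (n<1+n 4) (<⇒≤ 6≤n) count₃)
                                   (∈-filter⁺ (_∈? alphabet 4 5) 1∈rest (here refl)))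
    where not-there : 1 ∉ 4 ∷ 5 ∷ 3 ∷ 2 ∷ []
          not-there (there (there (there (there ()))))

  rest-letters : All (_∈ from 4 len (n ∸ 3) ++ 3 ∷ 2 ∷ []) rest
  rest-letters = All.tabulate λ z∈ → letter z∈ (range (subst (_ ∈_) (sym u≡) (∈-++⁺ʳ (from 1 len n) (there (there z∈)))))
    where
    letter : ∀ {z} → z ∈ rest → 1 ≤ z × z ≤ n → z ∈ from 4 len (n ∸ 3) ++ 3 ∷ 2 ∷ []
    letter {1} 1∈ _ = contradiction 1∈ 1∉rest
    letter {2} _ _ = ∈-++⁺ʳ (from 4 len (n ∸ 3)) (there (here refl))
    letter {3} _ _ = ∈-++⁺ʳ (from 4 len (n ∸ 3)) (here refl)
    letter {suc (suc (suc (suc _)))} _ (_ , hi) =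
      ∈-++⁺ˡ (∈-from⁺ (s≤s (s≤s (s≤s (s≤s z≤n))))
                      (s≤s (subst (_ ≤_) (sym (m+[n∸m]≡n (≤-trans (s≤s (s≤s (s≤s z≤n))) (<⇒≤ 6≤n)))) hi)))

  rest-shape : rest ≡ from 4 len (n ∸ 3) ++ 3 ∷ 2 ∷ []
  rest-shape = determined-by-short-sublists (from4-then-3-2-unique (n ∸ 3)) rest-letters short
    where
    short : ∀ {B} → B ⊆ from 4 len (n ∸ 3) ++ 3 ∷ 2 ∷ [] → length B ≤ 2 → restrict B rest ≡ B
    short {B} B⊆ |B|≤2 with x , y , 3<x , x<y , y≤n , B⊆xy32 ← short-sublist-cover 6≤n B⊆ |B|≤2 = begin
      restrict B rest                                  ≡⟨ restrict-restrict (into-alphabet ∘ Any-resp-⊆ B⊆xy32) rest ⟨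
      restrict B (restrict (alphabet x y) rest)        ≡⟨ cong (restrict B) (restrict-rest 3<x x<y y≤n count₃) ⟩
      restrict B (x ∷ y ∷ 3 ∷ 2 ∷ [])                  ≡⟨ restrict-sublist xy32-unique B⊆xy32 ⟩
      B                                                ∎
      where
      open ≡-Reasoning
      into-alphabet : ∀ {z} → z ∈ x ∷ y ∷ 3 ∷ 2 ∷ [] → z ∈ alphabet x y
      into-alphabet (here refl) = there (there (there (here refl)))
      into-alphabet (there (here refl)) = there (there (there (there (here refl))))
      into-alphabet (there (there (here refl))) = there (there (here refl))
      into-alphabet (there (there (there (here refl)))) = there (here refl)
      xy32-unique : Unique (x ∷ y ∷ 3 ∷ 2 ∷ [])
      xy32-unique = (<⇒≢ x<y ∷ above 3<x ∷ above 2<x ∷ []) ∷ (above 3<y ∷ above (<-trans (n<1+n 2) 3<y) ∷ []) ∷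
                    ((λ ()) ∷ []) ∷ [] ∷ []
        where
        above : ∀ {a b} → a < b → b ≢ a
        above a<b = <⇒≢ a<b ∘ sym
        2<x : 2 < x
        2<x = <-trans (n<1+n 2) 3<x
        3<y : 3 < y
        3<y = <-trans 3<x x<y

n∸2≡suc[n∸3] : ∀ {n} → 3 ≤ n → n ∸ 2 ≡ suc (n ∸ 3)
n∸2≡suc[n∸3] (s≤s (s≤s (s≤s _))) = refl

lemma22 : (n : ℕ) → 6 ≤ n → (u : List ℕ)
    → (∀ {x} → x ∈ u → 1 ≤ x × x ≤ n)
    → (∀ {x} → x ∈ u → 2 ≤ count x u)
    → FW≡ u 4
    → AltLength5 u
    → take n u ≡ from 1 len n
    → (∃[ init ] u ≡ init ++ (2 ∷ []))
    → (∃[ rest ] drop n u ≡ 1 ∷ 3 ∷ rest)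
    → u ≡ from 1 len n ++ (1 ∷ []) ++ from 3 len (n ∸ 2) ++ (3 ∷ 2 ∷ [])
lemma22 n 6≤n u range twice (forms , _) (ababa , free) take≡ ends-with-2 (rest , drop≡) = begin
  u                                                              ≡⟨ u≡ ⟩
  from 1 len n ++ 1 ∷ 3 ∷ rest
    ≡⟨ cong (λ r → from 1 len n ++ 1 ∷ 3 ∷ r) (rest-shape 6≤n range twice forms ababa free u≡ ends-with-2) ⟩
  from 1 len n ++ 1 ∷ 3 ∷ from 4 len (n ∸ 3) ++ 3 ∷ 2 ∷ []        ≡⟨ cong (λ r → from 1 len n ++ 1 ∷ r ++ 3 ∷ 2 ∷ []) tail≡ ⟨
  from 1 len n ++ (1 ∷ []) ++ from 3 len (n ∸ 2) ++ (3 ∷ 2 ∷ [])  ∎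
  where
  open ≡-Reasoning
  u≡ : u ≡ from 1 len n ++ 1 ∷ 3 ∷ rest
  u≡ = trans (sym (take++drop≡id n u)) (cong₂ _++_ take≡ drop≡)
  tail≡ : from 3 len (n ∸ 2) ≡ 3 ∷ from 4 len (n ∸ 3)
  tail≡ = trans (cong (from 3 len_) (n∸2≡suc[n∸3] (≤-trans (s≤s (s≤s (s≤s z≤n))) 6≤n))) (from-suc 3 (n ∸ 3))
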